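{- Let $\mathcal{T}$ be a test cover of $[n]$ and let $\mathcal{T}^*$ be the collection obtained from $\mathcal{T}$ by adding every singleton $\{i\}$, $i\in[n]$, not already in $\mathcal{T}$. Then for every positive integer $k$, $\mathcal{T}^*$ contains a $k$-mini test cover if and only if $\mathcal{T}$ contains a $k$-mini test cover.
   Context: $[n]=\{1,\ldots,n\}$ is the set of items; tests are subsets of $[n]$ and $\mathcal{T}$ is a collection of distinct tests. A test $T$ separates distinct items $i,j$ if $|\{i,j\}\cap T|=1$; a collection of tests is a test cover of $[n]$ if every pair of distinct items is separated by one of its tests. The classes induced by a collection $\mathcal{F}$ of tests are the equivalence classes of the relation "$i,j$ are not separated by any test of $\mathcal{F}$". A subcollection $\mathcal{F}$ of a collection of tests is a $k$-mini test cover if $|\mathcal{F}|\le 2k$ and $\mathcal{F}$ induces at least $|\mathcal{F}|+k$ classes. -}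

module Defs where

open import Data.Nat using (ℕ; _≤_; _+_; _*_; _<ᵇ_)
open import Data.Fin using (Fin; toℕ)
open import Data.Fin.Subset using (Subset; _∈_; _∉_; ⁅_⁆)
open import Data.Bool using (Bool; true; false; not; _xor_; _∧_)
import Data.Bool.Properties as BoolP
open import Data.Vec using (lookup)
import Data.Vec.Properties as VecP
open import Data.List using (List; []; _∷_; _++_; map; length; filter; filterᵇ; allFin)
open import Data.Bool.ListAction using (any; all)
open import Data.List.Relation.Unary.Any using (Any)
open import Data.List.Relation.Unary.Unique.Propositional using (Unique)
import Data.List.Membership.Propositional as LM
import Data.List.Membership.DecPropositional as DecM
open import Data.Product using (Σ; _×_)
open import Data.Sum using (_⊎_)
open import Relation.Binary.PropositionalEquality using (_≡_; _≢_)
open import Relation.Binary.Definitions using (DecidableEquality)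
open import Relation.Nullary using (¬?)

Separates : {n : ℕ} → Subset n → Fin n → Fin n → Set
Separates T i j = (i ∈ T × j ∉ T) ⊎ (i ∉ T × j ∈ T)

TestCover : {n : ℕ} → List (Subset n) → Set
TestCover {n} 𝒯 = (i j : Fin n) → i ≢ j → Any (λ T → Separates T i j) 𝒯

sepᵇ : {n : ℕ} → Subset n → Fin n → Fin n → Bool
sepᵇ T i j = lookup T i xor lookup T j

sepByᵇ : {n : ℕ} → List (Subset n) → Fin n → Fin n → Bool
sepByᵇ ℱ i j = any (λ T → sepᵇ T i j) ℱ

isLeaderᵇ : {n : ℕ} → List (Subset n) → Fin n → Bool
isLeaderᵇ {n} ℱ i = all (λ j → sepByᵇ ℱ j i) (filterᵇ (λ j → toℕ j <ᵇ toℕ i) (allFin n))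

-- number of classes induced by ℱ (= number of class representatives,
-- each class counted via its least element)
numClasses : {n : ℕ} → List (Subset n) → ℕ
numClasses {n} ℱ = length (filterᵇ (isLeaderᵇ ℱ) (allFin n))

Subcollection : {n : ℕ} → List (Subset n) → List (Subset n) → Set
Subcollection ℱ 𝒯 = Unique ℱ × (∀ {T} → T LM.∈ ℱ → T LM.∈ 𝒯)

IsMiniTestCover : {n : ℕ} → ℕ → List (Subset n) → List (Subset n) → Set
IsMiniTestCover k 𝒯 ℱ =
  Subcollection ℱ 𝒯 × (length ℱ ≤ 2 * k) × (length ℱ + k ≤ numClasses ℱ)

HasMiniTestCover : {n : ℕ} → ℕ → List (Subset n) → Set
HasMiniTestCover k 𝒯 = Σ (List _) (IsMiniTestCover k 𝒯)

_≟ˢ_ : {n : ℕ} → DecidableEquality (Subset n)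
_≟ˢ_ = VecP.≡-dec BoolP._≟_

star : {n : ℕ} → List (Subset n) → List (Subset n)
star {n} 𝒯 = 𝒯 ++ map ⁅_⁆ (filter (λ i → ¬? (DecM._∈?_ _≟ˢ_ ⁅ i ⁆ 𝒯)) (allFin n))

-- Adding the singleton test {a} to a collection splits at most one class, the class C of a,
-- into {a} and C ∖ {a}; so it creates at most one new class. Hence dropping from a k-mini test
-- cover of 𝒯* the d singletons that are not tests of 𝒯 loses at most d classes while removing d
-- tests: what remains is a k-mini test cover inside 𝒯. The converse is trivial since 𝒯 ⊆ 𝒯*.
module Submission where

open import Defs
open import Data.Nat using (ℕ; _≤_)
open import Data.Fin.Subset using (Subset)
open import Data.List using (List)
open import Data.List.Relation.Unary.Unique.Propositional using (Unique)
open import Function.Bundles using (_⇔_)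

open import Algebra.Bundles using (CommutativeMonoid)
open import Data.Bool using (Bool; true; false; T; _∨_; _xor_)
open import Data.Bool.ListAction using (all; and)
open import Data.Bool.Properties
  using (∨-assoc; ∨-zeroʳ; ∨-commutativeMonoid; xor-same; xor-comm; T-≡)
open import Data.Empty using (⊥-elim)
open import Data.Fin using (Fin; toℕ; _<_; _≟_)
open import Data.Fin.Properties using (<-cmp; <-irrefl; <-asym; <-trans; <⇒≢)
open import Data.Fin.Subset using (⁅_⁆)
open import Data.Fin.Subset.Properties using (x∈⁅y⁆⇒x≡y)
open import Data.List using ([]; _∷_; length; filter; filterᵇ; allFin)
import Data.List.Membership.DecPropositional as DecMembership
open import Data.List.Membership.Propositional using (_∈_; _∉_; find)
open import Data.List.Membership.Propositional.Properties
  using (∈-allFin; ∈-filter⁺; ∈-filter⁻; ∈-++⁻; ∈-++⁺ˡ; ∈-map⁻)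
open import Data.List.Properties using (length-filter; filter-≐; map-cong)
open import Data.List.Relation.Unary.All as All using (All; []; _∷_)
open import Data.List.Relation.Unary.All.Properties using (all⁺; all⁻; ¬All⇒Any¬)
open import Data.List.Relation.Unary.AllPairs using ([]; _∷_)
open import Data.List.Relation.Unary.Any using (here; there)
import Data.List.Relation.Unary.Unique.Propositional.Properties as Unique
open import Data.Nat using (suc; _+_; _<ᵇ_; z≤n; s≤s; s≤s⁻¹)
open import Data.Nat.Properties
  using (<ᵇ⇒<; <⇒<ᵇ; +-suc; m≤n⇒m≤1+n; ≤-trans; module ≤-Reasoning)
open import Data.Product using (∃; _×_; _,_; proj₁; proj₂)
open import Data.Sum using (_⊎_; inj₁; inj₂)
open import Data.Vec using (lookup)
open import Data.Vec.Properties using (lookup⇒[]=)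
open import Function using (_∘_)
open import Function.Bundles using (mk⇔; Equivalence)
open import Relation.Binary.Definitions using (tri<; tri≈; tri>)
open import Relation.Binary.PropositionalEquality
open import Relation.Binary.Structures using (IsEquivalence)
open import Relation.Nullary using (¬_; yes; no)
open import Relation.Nullary.Decidable using (T?)
open import Relation.Unary using () renaming (Decidable to Decidable₁)
open import Algebra.Properties.CommutativeSemigroup
  (CommutativeMonoid.commutativeSemigroup ∨-commutativeMonoid) using (x∙yz≈y∙xz)

private
  variable
    n : ℕ

Separation : ℕ → Set
Separation n = Fin n → Fin n → Bool

Unseparated : Separation n → Fin n → Fin n → Set
Unseparated s i j = s i j ≡ false

_∨ₛ_ : Separation n → Separation n → Separation n
(s ∨ₛ t) i j = s i j ∨ t i j

∨≡false⇒ : ∀ {a b} → a ∨ b ≡ false → a ≡ false × b ≡ false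
∨≡false⇒ {false} {false} _ = refl , refl

¬T⇒≡false : ∀ {b} → ¬ T b → b ≡ false
¬T⇒≡false {false} _  = refl
¬T⇒≡false {true}  ¬t = ⊥-elim (¬t _)

xor≡false-trans : ∀ a b c → a xor b ≡ false → b xor c ≡ false → a xor c ≡ false
xor≡false-trans false false false _ _ = refl
xor≡false-trans true  true  true  _ _ = refl

sepᵇ-isEquivalence : (T : Subset n) → IsEquivalence (Unseparated (sepᵇ T))
sepᵇ-isEquivalence T = record
  { refl  = λ {i} → xor-same (lookup T i)
  ; sym   = λ {i j} p → trans (xor-comm (lookup T j) (lookup T i)) p
  ; trans = λ {i j k} → xor≡false-trans (lookup T i) (lookup T j) (lookup T k)
  }

∨ₛ-isEquivalence : {s t : Separation n} → IsEquivalence (Unseparated s) →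
                   IsEquivalence (Unseparated t) → IsEquivalence (Unseparated (s ∨ₛ t))
∨ₛ-isEquivalence s-eq t-eq = record
  { refl  = cong₂ _∨_ (S.refl) (T.refl)
  ; sym   = λ p → let p₁ , p₂ = ∨≡false⇒ p in cong₂ _∨_ (S.sym p₁) (T.sym p₂)
  ; trans = λ p q → let p₁ , p₂ = ∨≡false⇒ p; q₁ , q₂ = ∨≡false⇒ q
                    in cong₂ _∨_ (S.trans p₁ q₁) (T.trans p₂ q₂)
  }
  where
  module S = IsEquivalence s-eq
  module T = IsEquivalence t-eq

sepByᵇ-isEquivalence : (ℱ : List (Subset n)) → IsEquivalence (Unseparated (sepByᵇ ℱ))
sepByᵇ-isEquivalence []      = record { refl = refl ; sym = λ _ → refl ; trans = λ _ _ → refl }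
sepByᵇ-isEquivalence (T ∷ ℱ) = ∨ₛ-isEquivalence (sepᵇ-isEquivalence T) (sepByᵇ-isEquivalence ℱ)

below : Fin n → List (Fin n)
below {n} i = filterᵇ (λ j → toℕ j <ᵇ toℕ i) (allFin n)

∈-below⁺ : {i j : Fin n} → j < i → j ∈ below i
∈-below⁺ {n} {i} {j} j<i = ∈-filter⁺ (T? ∘ λ j → toℕ j <ᵇ toℕ i) (∈-allFin j) (<⇒<ᵇ j<i)

∈-below⁻ : {i j : Fin n} → j ∈ below i → j < i
∈-below⁻ {n} {i} j∈ = <ᵇ⇒< _ _ (proj₂ (∈-filter⁻ (T? ∘ λ j → toℕ j <ᵇ toℕ i) {xs = allFin n} j∈))

-- As isLeaderᵇ and numClasses, but for an arbitrary separation: numClasses ℱ is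
-- definitionally classCount (sepByᵇ ℱ).
leaderᵇ : Separation n → Fin n → Bool
leaderᵇ s i = all (λ j → s j i) (below i)

classCount : Separation n → ℕ
classCount {n} s = length (filterᵇ (leaderᵇ s) (allFin n))

classCount-cong : {s t : Separation n} → (∀ i j → s i j ≡ t i j) → classCount s ≡ classCount t
classCount-cong {n} {s} {t} s≗t =
  cong length (filter-≐ (T? ∘ leaderᵇ s) (T? ∘ leaderᵇ t)
                        (subst T (leader≡ _) , subst T (sym (leader≡ _))) (allFin n))
  where
  leader≡ : ∀ i → leaderᵇ s i ≡ leaderᵇ t i
  leader≡ i = cong and (map-cong (λ j → s≗t j i) (below i))

leader⇒separated : (s : Separation n) {i j : Fin n} → leaderᵇ s i ≡ true → j < i → s j i ≡ true
leader⇒separated s {i} {j} leader j<i =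
  Equivalence.to T-≡ (All.lookup (all⁺ _ _ (Equivalence.from T-≡ leader)) (∈-below⁺ j<i))

separated⇒leader : (s : Separation n) {i : Fin n} → (∀ {j} → j < i → s j i ≡ true) →
                   leaderᵇ s i ≡ true
separated⇒leader s {i} separated = Equivalence.to T-≡ (all⁻ _ (All.tabulate below⇒separated))
  where
  below⇒separated : ∀ {j} → j ∈ below i → T (s j i)
  below⇒separated j∈ = Equivalence.from T-≡ (separated (∈-below⁻ j∈))

nonLeader⇒unseparated : (s : Separation n) {i : Fin n} → leaderᵇ s i ≡ false →
                        ∃ λ j → j < i × Unseparated s j i
nonLeader⇒unseparated s {i} nonLeader =
  let j , j∈ , ¬sji = find (¬All⇒Any¬ (T? ∘ λ j → s j i) (below i) (subst T nonLeader ∘ all⁻ _))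
  in j , ∈-below⁻ j∈ , ¬T⇒≡false ¬sji

length-filterᵇ-mono : {A : Set} (p q : A → Bool) (xs : List A) →
                      (∀ {x} → x ∈ xs → q x ≡ true → p x ≡ true) →
                      length (filterᵇ q xs) ≤ length (filterᵇ p xs)
length-filterᵇ-mono p q [] _ = z≤n
length-filterᵇ-mono p q (x ∷ xs) q⇒p
  with ih ← length-filterᵇ-mono p q xs (q⇒p ∘ there) | q x in qx | p x in px
... | false | false = ih
... | false | true  = m≤n⇒m≤1+n ih
... | true  | true  = s≤s ih
... | true  | false with () ← trans (sym (q⇒p (here refl) qx)) px

length-filterᵇ-≤-suc : {A : Set} (p q : A → Bool) {xs : List A} → Unique xs →
                       (∀ {x} → p x ≡ true → q x ≡ true) →
                       (∀ {x y} → q x ≡ true → p x ≡ false → q y ≡ true → p y ≡ false → x ≡ y) →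
                       length (filterᵇ q xs) ≤ suc (length (filterᵇ p xs))
length-filterᵇ-≤-suc p q [] _ _ = z≤n
length-filterᵇ-≤-suc p q {x ∷ xs} (x∉xs ∷ unique) p⇒q atMostOne
  with q x in qx | p x in px
... | true  | true  = s≤s (length-filterᵇ-≤-suc p q unique p⇒q atMostOne)
... | false | false = length-filterᵇ-≤-suc p q unique p⇒q atMostOne
... | false | true  with () ← trans (sym (p⇒q px)) qx
... | true  | false = s≤s (length-filterᵇ-mono p q xs only-x-is-extra)
  where
  only-x-is-extra : ∀ {y} → y ∈ xs → q y ≡ true → p y ≡ true
  only-x-is-extra {y} y∈xs qy with p y in py
  ... | true  = refl
  ... | false = ⊥-elim (All.lookup x∉xs y∈xs (atMostOne qx px qy py))

lookup-⁅⁆-≢ : {a j : Fin n} → j ≢ a → lookup ⁅ a ⁆ j ≡ false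
lookup-⁅⁆-≢ {a = a} {j} j≢a with lookup ⁅ a ⁆ j in eq
... | false = refl
... | true  = ⊥-elim (j≢a (x∈⁅y⁆⇒x≡y a (lookup⇒[]= j ⁅ a ⁆ eq)))

module AddSingleton {s : Separation n} (s-eq : IsEquivalence (Unseparated s)) (a : Fin n) where

  private module S = IsEquivalence s-eq

  s⁺ : Separation n
  s⁺ = sepᵇ ⁅ a ⁆ ∨ₛ s

  leader-mono : {x : Fin n} → leaderᵇ s x ≡ true → leaderᵇ s⁺ x ≡ true
  leader-mono leader = separated⇒leader s⁺ λ j<x →
    trans (cong (_ ∨_) (leader⇒separated s leader j<x)) (∨-zeroʳ _)

  unseparated⁺ : {j y : Fin n} → j ≢ a → y ≢ a → Unseparated s j y → Unseparated s⁺ j y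
  unseparated⁺ j≢a y≢a sjy rewrite lookup-⁅⁆-≢ j≢a | lookup-⁅⁆-≢ y≢a = sjy

  leader⁺-away-from-a : {y z : Fin n} → leaderᵇ s⁺ y ≡ true → z < y → z ≢ a → y ≢ a →
                        ¬ Unseparated s z y
  leader⁺-away-from-a leader z<y z≢a y≢a szy
    with () ← trans (sym (leader⇒separated s⁺ leader z<y)) (unseparated⁺ z≢a y≢a szy)

  NewLeader : Fin n → Set
  NewLeader x = leaderᵇ s⁺ x ≡ true × leaderᵇ s x ≡ false

  newLeader-cases : {x : Fin n} → NewLeader x → x ≡ a ⊎ (a < x × Unseparated s a x)
  newLeader-cases {x} (leader⁺ , nonLeader) with x ≟ a
  ... | yes x≡a = inj₁ x≡a
  ... | no  x≢a with j , j<x , sjx ← nonLeader⇒unseparated s nonLeader | j ≟ a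
  ...   | yes refl = inj₂ (j<x , sjx)
  ...   | no  j≢a  = ⊥-elim (leader⁺-away-from-a leader⁺ j<x j≢a x≢a sjx)

  -- The larger of two new leaders would have a smaller s-equivalent element other than a.
  newLeaders-incomparable : {x y : Fin n} → NewLeader x → NewLeader y → ¬ x < y
  newLeaders-incomparable new-x new-y x<y with newLeader-cases new-x | newLeader-cases new-y
  ... | inj₁ refl        | inj₁ refl = <-irrefl refl x<y
  ... | inj₂ (a<x , _)   | inj₁ refl = <-asym a<x x<y
  ... | inj₁ refl        | inj₂ (a<y , say) =
    let j , j<a , sja = nonLeader⇒unseparated s (proj₂ new-x)
    in leader⁺-away-from-a (proj₁ new-y) (<-trans j<a a<y) (<⇒≢ j<a) (≢-sym (<⇒≢ a<y))
                           (S.trans sja say)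
  ... | inj₂ (a<x , sax) | inj₂ (a<y , say) =
    leader⁺-away-from-a (proj₁ new-y) x<y (≢-sym (<⇒≢ a<x)) (≢-sym (<⇒≢ a<y))
                        (S.trans (S.sym sax) say)

  newLeader-unique : {x y : Fin n} → NewLeader x → NewLeader y → x ≡ y
  newLeader-unique {x} {y} new-x new-y with <-cmp x y
  ... | tri< x<y _ _ = ⊥-elim (newLeaders-incomparable new-x new-y x<y)
  ... | tri≈ _ x≡y _ = x≡y
  ... | tri> _ _ y<x = ⊥-elim (newLeaders-incomparable new-y new-x y<x)

  classCount-addSingleton : classCount s⁺ ≤ suc (classCount s)
  classCount-addSingleton =
    length-filterᵇ-≤-suc (leaderᵇ s) (leaderᵇ s⁺) (Unique.allFin⁺ n) leader-mono
      (λ qx px qy py → newLeader-unique (qx , px) (qy , py))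

IsSingleton : Subset n → Set
IsSingleton {n} T = ∃ λ (a : Fin n) → T ≡ ⁅ a ⁆

module _ {n} {P : Subset n → Set} (P? : Decidable₁ P) where

  classCount-surplus-filter : {s : Separation n} → IsEquivalence (Unseparated s) →
    (ℱ : List (Subset n)) → All (λ T → ¬ P T → IsSingleton T) ℱ → (k : ℕ) →
    length ℱ + k ≤ classCount (s ∨ₛ sepByᵇ ℱ) →
    length (filter P? ℱ) + k ≤ classCount (s ∨ₛ sepByᵇ (filter P? ℱ))
  classCount-surplus-filter s-eq [] _ k surplus = surplus
  classCount-surplus-filter {s} s-eq (T ∷ ℱ) (T-singleton ∷ singletons) k surplus with P? T
  ... | yes _ = begin
    suc (length (filter P? ℱ)) + k                       ≡⟨ +-suc _ k ⟨
    length (filter P? ℱ) + suc k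
      ≤⟨ classCount-surplus-filter s∨T-eq ℱ singletons (suc k) surplus′ ⟩
    classCount ((s ∨ₛ sepᵇ T) ∨ₛ sepByᵇ (filter P? ℱ))  ≡⟨ reassoc (filter P? ℱ) ⟨
    classCount (s ∨ₛ sepByᵇ (T ∷ filter P? ℱ))          ∎
    where
    open ≤-Reasoning
    s∨T-eq : IsEquivalence (Unseparated (s ∨ₛ sepᵇ T))
    s∨T-eq = ∨ₛ-isEquivalence s-eq (sepᵇ-isEquivalence T)
    reassoc : ∀ 𝒢 → classCount (s ∨ₛ sepByᵇ (T ∷ 𝒢)) ≡ classCount ((s ∨ₛ sepᵇ T) ∨ₛ sepByᵇ 𝒢)
    reassoc 𝒢 = classCount-cong λ i j → sym (∨-assoc (s i j) _ _)
    surplus′ : length ℱ + suc k ≤ classCount ((s ∨ₛ sepᵇ T) ∨ₛ sepByᵇ ℱ)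
    surplus′ = subst₂ _≤_ (sym (+-suc _ k)) (reassoc ℱ) surplus
  ... | no ¬PT with a , refl ← T-singleton ¬PT =
    classCount-surplus-filter s-eq ℱ singletons k (s≤s⁻¹ (begin
      suc (length ℱ + k)                          ≤⟨ surplus ⟩
      classCount (s ∨ₛ sepByᵇ (⁅ a ⁆ ∷ ℱ))        ≡⟨ classCount-cong swap ⟩
      classCount (sepᵇ ⁅ a ⁆ ∨ₛ (s ∨ₛ sepByᵇ ℱ))  ≤⟨ AddSingleton.classCount-addSingleton s∨ℱ-eq a ⟩
      suc (classCount (s ∨ₛ sepByᵇ ℱ))            ∎))
    where
    open ≤-Reasoning
    s∨ℱ-eq : IsEquivalence (Unseparated (s ∨ₛ sepByᵇ ℱ))
    s∨ℱ-eq = ∨ₛ-isEquivalence s-eq (sepByᵇ-isEquivalence ℱ)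
    swap : ∀ i j → s i j ∨ (sepᵇ ⁅ a ⁆ i j ∨ sepByᵇ ℱ i j) ≡ sepᵇ ⁅ a ⁆ i j ∨ (s i j ∨ sepByᵇ ℱ i j)
    swap i j = x∙yz≈y∙xz (s i j) (sepᵇ ⁅ a ⁆ i j) (sepByᵇ ℱ i j)

  -- sepByᵇ [] is constantly false, so sepByᵇ [] ∨ₛ s reduces to s.
  numClasses-surplus-filter : (ℱ : List (Subset n)) → All (λ T → ¬ P T → IsSingleton T) ℱ →
    {k : ℕ} → length ℱ + k ≤ numClasses ℱ → length (filter P? ℱ) + k ≤ numClasses (filter P? ℱ)
  numClasses-surplus-filter ℱ singletons =
    classCount-surplus-filter (sepByᵇ-isEquivalence []) ℱ singletons _

∈-star⁻ : {𝒯 : List (Subset n)} {T : Subset n} → T ∈ star 𝒯 → T ∉ 𝒯 → IsSingleton T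
∈-star⁻ {𝒯 = 𝒯} T∈𝒯* T∉𝒯 with ∈-++⁻ 𝒯 T∈𝒯*
... | inj₁ T∈𝒯         = ⊥-elim (T∉𝒯 T∈𝒯)
... | inj₂ T∈singletons = let a , _ , T≡⁅a⁆ = ∈-map⁻ ⁅_⁆ T∈singletons in a , T≡⁅a⁆

module _ {n} (𝒯 : List (Subset n)) (k : ℕ) where

  _∈𝒯? : Decidable₁ (_∈ 𝒯)
  T ∈𝒯? = DecMembership._∈?_ _≟ˢ_ T 𝒯

  HasMiniTestCover-star⁻ : HasMiniTestCover k (star 𝒯) → HasMiniTestCover k 𝒯
  HasMiniTestCover-star⁻ (ℱ , (unique , ℱ⊆𝒯*) , size≤2k , surplus) =
    filter _∈𝒯? ℱ ,
    (Unique.filter⁺ _∈𝒯? unique , proj₂ ∘ ∈-filter⁻ _∈𝒯? {xs = ℱ}) ,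
    ≤-trans (length-filter _∈𝒯? ℱ) size≤2k ,
    numClasses-surplus-filter _∈𝒯? ℱ (All.tabulate (∈-star⁻ ∘ ℱ⊆𝒯*)) surplus

  HasMiniTestCover-star⁺ : HasMiniTestCover k 𝒯 → HasMiniTestCover k (star 𝒯)
  HasMiniTestCover-star⁺ (ℱ , (unique , ℱ⊆𝒯) , size≤2k , surplus) =
    ℱ , (unique , ∈-++⁺ˡ ∘ ℱ⊆𝒯) , size≤2k , surplus

lemma3 : (n : ℕ) (𝒯 : List (Subset n)) → Unique 𝒯 → TestCover 𝒯 →
         (k : ℕ) → 1 ≤ k →
         HasMiniTestCover k (star 𝒯) ⇔ HasMiniTestCover k 𝒯
lemma3 n 𝒯 _ _ k _ = mk⇔ (HasMiniTestCover-star⁻ 𝒯 k) (HasMiniTestCover-star⁺ 𝒯 k)
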